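{- For all $m,s \in \mathbb{N}$ there exists $t_0$ such that for all $t \geq t_0$ the following holds. Let $H$ be a $3$-graph and let $G \subseteq \partial H$ be a copy of $K_{t,t}$ which has an $m$-multicoloring. Then there exists $F \subseteq G$ with $F$ a copy of $K_{s,s}$ such that $F$ has either a rainbow list-edge-coloring, or an $m$-multicoloring $\chi_1,\dots,\chi_m$ whose colorings are pairwise disjoint and each of which is monochromatic or canonical (with respect to the bipartition of $F$).
   Context: A $3$-graph $H$ is a family of $3$-element subsets of a finite vertex set; its shadow is $\partial H = \{\{u,v\} : \{u,v\} \text{ is contained in some edge of } H\}$. For a pair $e$, $N_H(e) = \{v \notin e : e \cup \{v\} \in H\}$. For a graph $G \subseteq \partial H$ and $e \in G$, the list of $e$ is $L_G(e) = N_H(e) \setminus V(G)$ (its elements are called colors), and $L_G = \bigcup_{e \in G} L_G(e)$. A list-edge-coloring of $G$ is a map $\chi : G \to L_G$ with $\chi(e) \in L_G(e)$ for all $e \in G$. Two list-edge-colorings $\chi_1,\chi_2$ are disjoint if $\chi_1(e) \neq \chi_2(f)$ for all $e,f \in G$. An $m$-multicoloring of $G$ is a family of list-edge-colorings $\chi_1,\dots,\chi_m$ of $G$ with $\chi_i(e) \neq \chi_j(e)$ for all $e \in G$ and $i \neq j$. For a bipartite graph $F$ with parts $X,Y$ and an edge-coloring $\chi$: $\chi$ is $Z$-canonical ($Z \in \{X,Y\}$) if for each $z \in Z$ all edges of $F$ at $z$ receive the same color and edges at different vertices of $Z$ receive different colors; $\chi$ is canonical if it is $X$-canonical or $Y$-canonical;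 $\chi$ is rainbow if all edges get distinct colors; $\chi$ is monochromatic if all edges get the same color. -}

module Defs where

open import Data.Nat using (ℕ; _≤_)
open import Data.Fin using (Fin)
open import Data.Fin.Subset using (Subset; ⁅_⁆; _∪_; ∣_∣)
open import Data.Product using (Σ; ∃; _×_; _,_)
open import Data.Sum using (_⊎_)
open import Relation.Nullary using (¬_)
open import Relation.Binary.PropositionalEquality using (_≡_; _≢_)
open import Function.Definitions using (Injective)

record ThreeGraph (n : ℕ) : Set₁ where
  field
    Edge     : Subset n → Set
    edgeSize : ∀ S → Edge S → ∣ S ∣ ≡ 3
open ThreeGraph public

triple : ∀ {n} → Fin n → Fin n → Fin n → Subset n
triple u v w = ⁅ u ⁆ ∪ (⁅ v ⁆ ∪ ⁅ w ⁆)

InNbhd : ∀ {n} → ThreeGraph n → Fin n → Fin n → Fin n → Set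
InNbhd H u v c = c ≢ u × c ≢ v × Edge H (triple u v c)

InShadow : ∀ {n} → ThreeGraph n → Fin n → Fin n → Set
InShadow H u v = u ≢ v × ∃ λ w → Edge H (triple u v w)

-- A copy of K_{t,t} on vertex set Fin n: parts X = image of x, Y = image of y;
-- its edges are the pairs {x i, y j}.
record Copy (n t : ℕ) : Set where
  field
    xs       : Fin t → Fin n
    ys       : Fin t → Fin n
    xs-inj   : Injective _≡_ _≡_ xs
    ys-inj   : Injective _≡_ _≡_ ys
    disjoint : ∀ i j → xs i ≢ ys j
open Copy public

CopyInShadow : ∀ {n t} → ThreeGraph n → Copy n t → Set
CopyInShadow H G = ∀ i j → InShadow H (xs G i) (ys G j)

InV : ∀ {n t} → Copy n t → Fin n → Set
InV {t = t} G c = (Σ (Fin t) λ i → c ≡ xs G i) ⊎ (Σ (Fin t) λ j → c ≡ ys G j)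

InList : ∀ {n t} → ThreeGraph n → (G : Copy n t) → Fin t → Fin t → Fin n → Set
InList H G i j c = InNbhd H (xs G i) (ys G j) c × ¬ InV G c

Coloring : ℕ → ℕ → Set
Coloring n t = Fin t → Fin t → Fin n

IsListColoring : ∀ {n t} → ThreeGraph n → Copy n t → Coloring n t → Set
IsListColoring H G χ = ∀ i j → InList H G i j (χ i j)

IsMulticoloring : ∀ {n t} → (m : ℕ) → ThreeGraph n → Copy n t → (Fin m → Coloring n t) → Set
IsMulticoloring m H G χ =
  (∀ k → IsListColoring H G (χ k)) ×
  (∀ k l i j → k ≢ l → χ k i j ≢ χ l i j)

PairwiseDisjoint : ∀ {n t m} → (Fin m → Coloring n t) → Set
PairwiseDisjoint χ = ∀ k l → k ≢ l → ∀ i j i' j' → χ k i j ≢ χ l i' j'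

Rainbow : ∀ {n t} → Coloring n t → Set
Rainbow χ = ∀ i j i' j' → χ i j ≡ χ i' j' → i ≡ i' × j ≡ j'

Monochromatic : ∀ {n t} → Coloring n t → Set
Monochromatic χ = ∀ i j i' j' → χ i j ≡ χ i' j'

XCanonical : ∀ {n t} → Coloring n t → Set
XCanonical χ = (∀ i j j' → χ i j ≡ χ i j') × (∀ i i' j j' → i ≢ i' → χ i j ≢ χ i' j')

YCanonical : ∀ {n t} → Coloring n t → Set
YCanonical χ = (∀ i i' j → χ i j ≡ χ i' j) × (∀ i i' j j' → j ≢ j' → χ i j ≢ χ i' j')

Canonical : ∀ {n t} → Coloring n t → Set
Canonical χ = XCanonical χ ⊎ YCanonical χ

record SubCopy {n t} (s : ℕ) (G : Copy n t) : Set where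
  field
    as    : Fin s → Fin t
    bs    : Fin s → Fin t
    as-inj : Injective _≡_ _≡_ as
    bs-inj : Injective _≡_ _≡_ bs
open SubCopy public

subCopy : ∀ {n t s} (G : Copy n t) → SubCopy s G → Copy n s
subCopy G F = record
  { xs = λ i → xs G (as F i)
  ; ys = λ j → ys G (bs F j)
  ; xs-inj = λ e → as-inj F (xs-inj G e)
  ; ys-inj = λ e → bs-inj F (ys-inj G e)
  ; disjoint = λ i j → disjoint G (as F i) (bs F j)
  }

module Submission where

-- Passing to sub-grids, one colouring at a time can be made "typed": every row and every column is
-- either constant or injective (an Erdős–Szekeres style dichotomy, applied first to each row and then to
-- each column). A colouring injective along both rows and columns becomes rainbow once columns sharing
-- a colour on the chosen rows are discarded greedily, since each column conflicts with few others.
-- Otherwise each colouring is monochromatic, X-canonical or Y-canonical, and one more round of greedy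
-- restriction for every pair k ≠ l makes the colour sets of χₖ and χₗ disjoint; the pointwise distinctness
-- of a multicolouring settles the monochromatic and the diagonal cases.

open import Defs
open import Data.Nat using (ℕ; zero; suc; _+_; _*_; _≤_; _<_; z≤n; s≤s; _≤?_)
open import Data.Nat.Properties
open import Data.Nat.GeneralisedArithmetic using (fold)
open import Data.Fin as Fin using (Fin)
open import Data.List using (List; []; _∷_; _++_; length; filter; concatMap; map; allFin)
open import Data.List.Properties using (filter-notAll; length-++; length-map; length-tabulate)
open import Data.List.Membership.Propositional using (_∈_; _∉_; find; lose)
open import Data.List.Membership.Propositional.Properties
  using (∈-filter⁺; ∈-filter⁻; ∈-concatMap⁺; ∈-++⁺ˡ; ∈-++⁺ʳ; ∈-map⁺)
open import Data.List.Relation.Binary.Subset.Propositional using (_⊆_)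
open import Data.List.Relation.Binary.Subset.Propositional.Properties using (filter-⊆)
open import Data.List.Relation.Unary.Any using (Any; any?; here; there)
open import Data.List.Relation.Unary.All as All using (All; []; _∷_)
open import Data.List.Relation.Unary.All.Properties.Core using (¬All⇒Any¬)
open import Data.List.Relation.Unary.AllPairs using ([]; _∷_)
open import Data.List.Relation.Unary.Unique.Propositional using (Unique)
import Data.List.Relation.Unary.Unique.Propositional.Properties as Unique
open import Data.Product using (Σ; ∃; _×_; _,_; proj₁; proj₂; swap)
open import Data.Sum using (_⊎_; inj₁; inj₂)
import Data.Sum as Sum
open import Data.Empty using (⊥-elim)
open import Data.Unit using (⊤; tt)
open import Function using (_∘_; flip; case_of_)
open import Relation.Nullary using (¬_; Dec; yes; no; ¬?)
open import Relation.Unary using (Decidable)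
open import Relation.Unary.Properties using (∁?)
open import Relation.Binary.Definitions using (DecidableEquality)
open import Relation.Binary.PropositionalEquality using (_≡_; _≢_; refl; sym; trans; cong; subst; module ≡-Reasoning)

module _ {A : Set} where

  length-filter-∁ : {P : A → Set} (P? : Decidable P) (xs : List A) →
                    length (filter P? xs) + length (filter (∁? P?) xs) ≡ length xs
  length-filter-∁ P? [] = refl
  length-filter-∁ P? (x ∷ xs) with P? x
  ... | yes _ = cong suc (length-filter-∁ P? xs)
  ... | no _ = trans (+-suc _ _) (cong suc (length-filter-∁ P? xs))

  length≤1 : {xs : List A} → Unique xs → (∀ {a b} → a ∈ xs → b ∈ xs → a ≡ b) → length xs ≤ 1
  length≤1 {[]} _ _ = z≤n
  length≤1 {x ∷ []} _ _ = s≤s z≤n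
  length≤1 {x ∷ y ∷ xs} ((x≢y ∷ _) ∷ _) allEqual = ⊥-elim (x≢y (allEqual (here refl) (there (here refl))))

  ∷-unique : ∀ {x : A} {xs ys} → All (x ≢_) xs → ys ⊆ xs → Unique ys → Unique (x ∷ ys)
  ∷-unique x∉xs ys⊆xs ys! = All.tabulate (All.lookup x∉xs ∘ ys⊆xs) ∷ ys!

  ∷-⊆ : ∀ {x : A} {xs ys} → ys ⊆ xs → x ∷ ys ⊆ x ∷ xs
  ∷-⊆ ys⊆xs (here x≡y) = here x≡y
  ∷-⊆ ys⊆xs (there y∈ys) = there (ys⊆xs y∈ys)

  takeUnique : ∀ s (xs : List A) → Unique xs → s ≤ length xs →
               Σ (List A) λ ys → ys ⊆ xs × Unique ys × length ys ≡ s
  takeUnique zero xs _ _ = [] , (λ ()) , [] , refl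
  takeUnique (suc s) (x ∷ xs) (x∉xs ∷ xs!) (s≤s s≤∣xs∣) with takeUnique s xs xs! s≤∣xs∣
  ... | ys , ys⊆xs , ys! , refl = x ∷ ys , ∷-⊆ ys⊆xs , ∷-unique x∉xs ys⊆xs ys! , refl

  length-concatMap≤ : ∀ {B : Set} (h : A → List B) {c} (xs : List A) → (∀ {x} → x ∈ xs → length (h x) ≤ c) →
                      length (concatMap h xs) ≤ length xs * c
  length-concatMap≤ h [] _ = z≤n
  length-concatMap≤ h {c} (x ∷ xs) bounded = begin
    length (h x ++ concatMap h xs)          ≡⟨ length-++ (h x) ⟩
    length (h x) + length (concatMap h xs) ≤⟨ +-mono-≤ (bounded (here refl))
                                                         (length-concatMap≤ h xs (bounded ∘ there)) ⟩
    c + length xs * c                      ∎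
    where open ≤-Reasoning

  enumerate : ∀ s (xs : List A) → Unique xs → s ≤ length xs →
              Σ (Fin s → A) λ e → (∀ {i j} → e i ≡ e j → i ≡ j) × (∀ i → e i ∈ xs)
  enumerate zero _ _ _ = (λ ()) , (λ { {()} }) , (λ ())
  enumerate (suc s) (x ∷ xs) (x∉xs ∷ xs!) (s≤s s≤∣xs∣) with enumerate s xs xs! s≤∣xs∣
  ... | e , e-inj , e∈xs = e' , e'-inj , e'∈
    where
      e' : Fin (suc s) → A
      e' Fin.zero = x
      e' (Fin.suc i) = e i
      e'-inj : ∀ {i j} → e' i ≡ e' j → i ≡ j
      e'-inj {Fin.zero} {Fin.zero} _ = refl
      e'-inj {Fin.zero} {Fin.suc j} x≡ = ⊥-elim (All.lookup x∉xs (e∈xs j) x≡)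
      e'-inj {Fin.suc i} {Fin.zero} ≡x = ⊥-elim (All.lookup x∉xs (e∈xs i) (sym ≡x))
      e'-inj {Fin.suc i} {Fin.suc j} eq = cong Fin.suc (e-inj eq)
      e'∈ : ∀ i → e' i ∈ x ∷ xs
      e'∈ Fin.zero = here refl
      e'∈ (Fin.suc i) = there (e∈xs i)

module _ {A B : Set} (_≟_ : DecidableEquality B) where

  injection⇒length≤ : (h : A → B) {xs : List A} {ys : List B} → Unique xs →
                      (∀ {x x'} → x ∈ xs → x' ∈ xs → h x ≡ h x' → x ≡ x') → (∀ {x} → x ∈ xs → h x ∈ ys) →
                      length xs ≤ length ys
  injection⇒length≤ h {[]} _ _ _ = z≤n
  injection⇒length≤ h {x ∷ xs} {ys} (x∉xs ∷ xs!) injective maps = begin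
    suc (length xs)              ≤⟨ s≤s (injection⇒length≤ h xs! (λ a b → injective (there a) (there b)) maps-≢hx) ⟩
    suc (length (filter ≢hx? ys)) ≤⟨ filter-notAll ≢hx? ys (lose (maps (here refl)) (λ hx≢hx → hx≢hx refl)) ⟩
    length ys                    ∎
    where
      open ≤-Reasoning
      ≢hx? : Decidable (_≢ h x)
      ≢hx? b = ¬? (b ≟ h x)
      maps-≢hx : ∀ {x'} → x' ∈ xs → h x' ∈ filter ≢hx? ys
      maps-≢hx x'∈xs = ∈-filter⁺ ≢hx? (maps (there x'∈xs))
        (λ hx'≡hx → All.lookup x∉xs x'∈xs (sym (injective (there x'∈xs) (here refl) hx'≡hx)))

module _ {A : Set} (_≟_ : DecidableEquality A) where

  ∃-∉ : {xs ys : List A} → Unique ys → length xs < length ys → ∃ λ y → y ∈ ys × y ∉ xs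
  ∃-∉ {xs} {ys} ys! ∣xs∣<∣ys∣ = find (¬All⇒Any¬ (_∈? xs) ys λ ys⊆xs →
    <⇒≱ ∣xs∣<∣ys∣ (injection⇒length≤ _≟_ (λ y → y) ys! (λ _ _ eq → eq) (All.lookup ys⊆xs)))
    where open import Data.List.Membership.DecPropositional _≟_ using (_∈?_)

∃⊎∀ : ∀ {m} {P Q : Fin m → Set} → (∀ k → P k ⊎ Q k) → ∃ P ⊎ (∀ k → Q k)
∃⊎∀ {zero} _ = inj₂ λ ()
∃⊎∀ {suc m} P⊎Q with P⊎Q Fin.zero | ∃⊎∀ (P⊎Q ∘ Fin.suc)
... | inj₁ p₀ | _ = inj₁ (Fin.zero , p₀)
... | inj₂ _ | inj₁ (k , p) = inj₁ (Fin.suc k , p)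
... | inj₂ q₀ | inj₂ qs = inj₂ λ { Fin.zero → q₀ ; (Fin.suc k) → qs k }

constantOrInjectiveBound : ℕ → ℕ → ℕ
constantOrInjectiveBound a zero = 0
constantOrInjectiveBound a (suc b) = suc (a + constantOrInjectiveBound a b)

rowBound : ℕ → ℕ → ℕ → ℕ
rowBound M zero q = M
rowBound M (suc p) zero = M
rowBound M (suc p) (suc q) = constantOrInjectiveBound (rowBound M p (suc q)) (rowBound M (suc p) q)

typedBound : ℕ → ℕ
typedBound M = (P + P) + rowBound (M + M) P P
  where P = rowBound M M M

rainbowBound : ℕ → ℕ
rainbowBound s = s * suc (s * (s * 1))

disjointnessBound : ℕ → ℕ → ℕ
disjointnessBound m M = fold M (λ N → fold N (_* 3) m) m

gridBound : ℕ → ℕ → ℕ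
gridBound m s = fold (rainbowBound s + disjointnessBound m s) typedBound m

-- Both sides of K_{t,t} are indexed by V and colours lie in C; an edge-colouring is f : V → V → C with
-- f x y the colour of the edge between row x and column y, and vertex sets are duplicate-free lists.
module Grids {V C : Set} (_≟ᵛ_ : DecidableEquality V) (_≟ᶜ_ : DecidableEquality C) where

  Property : Set₁
  Property = List V → List V → Set

  _∩_ _∪_ : Property → Property → Property
  (P ∩ Q) A B = P A B × Q A B
  (P ∪ Q) A B = P A B ⊎ Q A B

  ConstantOn InjectiveOn : (V → C) → List V → Set
  ConstantOn h B = ∀ {y y'} → y ∈ B → y' ∈ B → h y ≡ h y'
  InjectiveOn h B = ∀ {y y'} → y ∈ B → y' ∈ B → h y ≡ h y' → y ≡ y'

  Rows Columns : ((V → C) → List V → Set) → (V → V → C) → Property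
  Rows P f A B = ∀ {x} → x ∈ A → P (f x) B
  Columns P f = flip (Rows P (flip f))

  RowType ColumnType Typed : (V → V → C) → Property
  RowType f = Rows ConstantOn f ∪ Rows InjectiveOn f
  ColumnType f = Columns ConstantOn f ∪ Columns InjectiveOn f
  Typed f = RowType f ∩ ColumnType f

  MonochromaticOn XCanonicalOn YCanonicalOn Structured RainbowOn : (V → V → C) → Property
  MonochromaticOn f = Rows ConstantOn f ∩ Columns ConstantOn f
  XCanonicalOn f = Rows ConstantOn f ∩ Columns InjectiveOn f
  YCanonicalOn f = Rows InjectiveOn f ∩ Columns ConstantOn f
  Structured f = MonochromaticOn f ∪ (XCanonicalOn f ∪ YCanonicalOn f)
  RainbowOn f A B = ∀ {x x' y y'} → x ∈ A → x' ∈ A → y ∈ B → y' ∈ B → f x y ≡ f x' y' → x ≡ x' × y ≡ y'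

  DisjointOn : (f g : V → V → C) → Property
  DisjointOn f g A B = ∀ {x x' y y'} → x ∈ A → x' ∈ A → y ∈ B → y' ∈ B → f x y ≢ g x' y'

  PointwiseDistinct : (f g : V → V → C) → Set
  PointwiseDistinct f g = ∀ x y → f x y ≢ g x y

  Hereditary : Property → Set
  Hereditary P = ∀ {A B A' B'} → A' ⊆ A → B' ⊆ B → P A B → P A' B'

  ∩-hereditary : ∀ {P Q} → Hereditary P → Hereditary Q → Hereditary (P ∩ Q)
  ∩-hereditary hP hQ A'⊆A B'⊆B (p , q) = hP A'⊆A B'⊆B p , hQ A'⊆A B'⊆B q

  ∪-hereditary : ∀ {P Q} → Hereditary P → Hereditary Q → Hereditary (P ∪ Q)
  ∪-hereditary hP hQ A'⊆A B'⊆B = Sum.map (hP A'⊆A B'⊆B) (hQ A'⊆A B'⊆B)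

  transpose-hereditary : ∀ {P} → Hereditary P → Hereditary (flip P)
  transpose-hereditary hP A'⊆A B'⊆B = hP B'⊆B A'⊆A

  rows-hereditary : ∀ {P} → (∀ {h B B'} → B' ⊆ B → P h B → P h B') → ∀ {f} → Hereditary (Rows P f)
  rows-hereditary hP A'⊆A B'⊆B rows x∈A' = hP B'⊆B (rows (A'⊆A x∈A'))

  constantOn-⊆ : ∀ {h B B'} → B' ⊆ B → ConstantOn h B → ConstantOn h B'
  constantOn-⊆ B'⊆B const y∈ y'∈ = const (B'⊆B y∈) (B'⊆B y'∈)

  injectiveOn-⊆ : ∀ {h B B'} → B' ⊆ B → InjectiveOn h B → InjectiveOn h B'
  injectiveOn-⊆ B'⊆B inj y∈ y'∈ = inj (B'⊆B y∈) (B'⊆B y'∈)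

  rows-∷ : ∀ {P f x A B} → P (f x) B → Rows P f A B → Rows P f (x ∷ A) B
  rows-∷ px rows (here refl) = px
  rows-∷ px rows (there x∈A) = rows x∈A

  rowsConstant-hereditary : ∀ {f} → Hereditary (Rows ConstantOn f)
  rowsConstant-hereditary = rows-hereditary (λ {h} → constantOn-⊆ {h})

  rowsInjective-hereditary : ∀ {f} → Hereditary (Rows InjectiveOn f)
  rowsInjective-hereditary = rows-hereditary (λ {h} → injectiveOn-⊆ {h})

  columnsConstant-hereditary : ∀ {f} → Hereditary (Columns ConstantOn f)
  columnsConstant-hereditary = transpose-hereditary rowsConstant-hereditary

  columnsInjective-hereditary : ∀ {f} → Hereditary (Columns InjectiveOn f)
  columnsInjective-hereditary = transpose-hereditary rowsInjective-hereditary

  rowType-hereditary : ∀ {f} → Hereditary (RowType f)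
  rowType-hereditary = ∪-hereditary rowsConstant-hereditary rowsInjective-hereditary

  typed-hereditary : ∀ {f} → Hereditary (Typed f)
  typed-hereditary =
    ∩-hereditary rowType-hereditary (∪-hereditary columnsConstant-hereditary columnsInjective-hereditary)

  structured-hereditary : ∀ {f} → Hereditary (Structured f)
  structured-hereditary =
    ∪-hereditary (∩-hereditary rowsConstant-hereditary columnsConstant-hereditary)
      (∪-hereditary (∩-hereditary rowsConstant-hereditary columnsInjective-hereditary)
                    (∩-hereditary rowsInjective-hereditary columnsConstant-hereditary))

  disjointOn-hereditary : ∀ {f g} → Hereditary (DisjointOn f g)
  disjointOn-hereditary A'⊆A B'⊆B disjoint x∈ x'∈ y∈ y'∈ = disjoint (A'⊆A x∈) (A'⊆A x'∈) (B'⊆B y∈) (B'⊆B y'∈)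

  record Subgrid (A B : List V) (a b : ℕ) (P : Property) : Set where
    constructor subgrid
    field
      {A' B'}   : List V
      A'⊆A      : A' ⊆ A
      B'⊆B      : B' ⊆ B
      A'-unique : Unique A'
      B'-unique : Unique B'
      a≤∣A'∣    : a ≤ length A'
      b≤∣B'∣    : b ≤ length B'
      property  : P A' B'

  whole : ∀ {A B a b} {P : Property} → Unique A → Unique B → a ≤ length A → b ≤ length B → P A B → Subgrid A B a b P
  whole = subgrid (λ x∈ → x∈) (λ y∈ → y∈)

  transpose : ∀ {A B a b P} → Subgrid B A b a (flip P) → Subgrid A B a b P
  transpose (subgrid B'⊆B A'⊆A B'! A'! b≤ a≤ p) = subgrid A'⊆A B'⊆B A'! B'! a≤ b≤ p

  mapProperty : ∀ {A B a b} {P Q : Property} → (∀ {A' B'} → P A' B' → Q A' B') → Subgrid A B a b P → Subgrid A B a b Q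
  mapProperty P⇒Q (subgrid A'⊆A B'⊆B A'! B'! a≤ b≤ p) = subgrid A'⊆A B'⊆B A'! B'! a≤ b≤ (P⇒Q p)

  keep : ∀ {A B a b} {P Q : Property} → Hereditary P → P A B → Subgrid A B a b Q → Subgrid A B a b (P ∩ Q)
  keep hP p (subgrid A'⊆A B'⊆B A'! B'! a≤ b≤ q) = subgrid A'⊆A B'⊆B A'! B'! a≤ b≤ (hP A'⊆A B'⊆B p , q)

  _>>=_ : ∀ {A B a b c d} {P Q : Property} → Subgrid A B a b P →
          (∀ {A' B'} → Unique A' → Unique B' → a ≤ length A' → b ≤ length B' → P A' B' → Subgrid A' B' c d Q) →
          Subgrid A B c d Q
  subgrid A₁⊆A B₁⊆B A₁! B₁! a≤ b≤ p >>= refine with refine A₁! B₁! a≤ b≤ p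
  ... | subgrid A₂⊆A₁ B₂⊆B₁ A₂! B₂! c≤ d≤ q = subgrid (A₁⊆A ∘ A₂⊆A₁) (B₁⊆B ∘ B₂⊆B₁) A₂! B₂! c≤ d≤ q

  ConstantOrInjective : (V → C) → ℕ → ℕ → List V → Set
  ConstantOrInjective h a b B = Σ (List V) λ B' → B' ⊆ B × Unique B' ×
    (a ≤ length B' × ConstantOn h B' ⊎ b ≤ length B' × InjectiveOn h B')

  constantOrInjective : ∀ h a b {B} → Unique B → constantOrInjectiveBound a b ≤ length B → ConstantOrInjective h a b B
  constantOrInjective h a zero _ _ = [] , (λ ()) , [] , inj₂ (z≤n , λ ())
  constantOrInjective h a (suc b) {y ∷ B₀} (y∉B₀ ∷ B₀!) (s≤s bound) = split (a ≤? length (y ∷ S))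
    where
      same? : Decidable (λ z → h z ≡ h y)
      same? z = h z ≟ᶜ h y
      S = filter same? B₀
      R = filter (∁? same?) B₀

      ∣S∣≤a : ¬ a ≤ length (y ∷ S) → length S ≤ a
      ∣S∣≤a a≰ = ≤-trans (n≤1+n _) (<⇒≤ (≰⇒> a≰))

      bound-R : length S ≤ a → constantOrInjectiveBound a b ≤ length R
      bound-R ∣S∣≤a = +-cancelˡ-≤ a _ _ (begin
        a + constantOrInjectiveBound a b ≤⟨ bound ⟩
        length B₀                        ≡⟨ length-filter-∁ same? B₀ ⟨
        length S + length R             ≤⟨ +-monoˡ-≤ (length R) ∣S∣≤a ⟩
        a + length R                    ∎)
        where open ≤-Reasoning

      ∈S⇒same : ∀ {z} → z ∈ S → h z ≡ h y
      ∈S⇒same z∈S = proj₂ (∈-filter⁻ same? {xs = B₀} z∈S)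

      ∈R⇒different : ∀ {z} → z ∈ R → h z ≢ h y
      ∈R⇒different z∈R = proj₂ (∈-filter⁻ (∁? same?) {xs = B₀} z∈R)

      y∷S-constant : ConstantOn h (y ∷ S)
      y∷S-constant z∈ z'∈ = trans (colour-y z∈) (sym (colour-y z'∈))
        where
          colour-y : ∀ {z} → z ∈ y ∷ S → h z ≡ h y
          colour-y (here refl) = refl
          colour-y (there z∈S) = ∈S⇒same z∈S

      y∷-injective : ∀ {B'} → B' ⊆ R → InjectiveOn h B' → InjectiveOn h (y ∷ B')
      y∷-injective B'⊆R inj (here refl) (here refl) _ = refl
      y∷-injective B'⊆R inj (here refl) (there z∈) hy≡hz = ⊥-elim (∈R⇒different (B'⊆R z∈) (sym hy≡hz))
      y∷-injective B'⊆R inj (there z∈) (here refl) hz≡hy = ⊥-elim (∈R⇒different (B'⊆R z∈) hz≡hy)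
      y∷-injective B'⊆R inj (there z∈) (there z'∈) hz≡hz' = inj z∈ z'∈ hz≡hz'

      extend : ConstantOrInjective h a b R → ConstantOrInjective h a (suc b) (y ∷ B₀)
      extend (B' , B'⊆R , B'! , inj₁ constant) = B' , there ∘ filter-⊆ _ B₀ ∘ B'⊆R , B'! , inj₁ constant
      extend (B' , B'⊆R , B'! , inj₂ (b≤ , injective)) =
        y ∷ B' , ∷-⊆ (filter-⊆ _ B₀ ∘ B'⊆R) , ∷-unique y∉B₀ (filter-⊆ _ B₀ ∘ B'⊆R) B'! ,
        inj₂ (s≤s b≤ , y∷-injective B'⊆R injective)

      split : Dec (a ≤ length (y ∷ S)) → ConstantOrInjective h a (suc b) (y ∷ B₀)
      split (yes a≤) =
        y ∷ S , ∷-⊆ (filter-⊆ same? B₀) , ∷-unique y∉B₀ (filter-⊆ same? B₀) (Unique.filter⁺ same? B₀!) ,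
        inj₁ (a≤ , y∷S-constant)
      split (no a≰) = extend (constantOrInjective h a b (Unique.filter⁺ (∁? same?) B₀!) (bound-R (∣S∣≤a a≰)))

  ManyRows : (V → V → C) → ℕ → ℕ → Property
  ManyRows f p q A B = p ≤ length A × Rows ConstantOn f A B ⊎ q ≤ length A × Rows InjectiveOn f A B

  -- Rows are treated one at a time, each shrinking the columns until it is constant or injective on them.
  manyRows : ∀ f M p q {A B} → Unique A → Unique B → p + q ≤ length A → rowBound M p q ≤ length B →
             Subgrid A B 0 M (ManyRows f p q)
  manyRows f M zero q _ B! _ M≤ = subgrid (λ ()) (λ y∈ → y∈) [] B! z≤n M≤ (inj₁ (z≤n , λ ()))
  manyRows f M (suc p) zero _ B! _ M≤ = subgrid (λ ()) (λ y∈ → y∈) [] B! z≤n M≤ (inj₂ (z≤n , λ ()))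
  manyRows f M (suc p) (suc q) {x ∷ A₀} (x∉A₀ ∷ A₀!) B! (s≤s pq≤) bound
    with constantOrInjective (f x) _ _ B! bound
  ... | B₁ , B₁⊆B , B₁! , inj₁ (∣B₁∣ , constant) = addConstant (manyRows f M p (suc q) A₀! B₁! pq≤ ∣B₁∣)
    where
      addConstant : Subgrid A₀ B₁ 0 M (ManyRows f p (suc q)) → Subgrid (x ∷ A₀) _ 0 M (ManyRows f (suc p) (suc q))
      addConstant (subgrid A'⊆ B'⊆ A'! B'! _ M≤ (inj₁ (p≤ , rows))) =
        subgrid (∷-⊆ A'⊆) (B₁⊆B ∘ B'⊆) (∷-unique x∉A₀ A'⊆ A'!) B'! z≤n M≤
                (inj₁ (s≤s p≤ , rows-∷ {P = ConstantOn} (constantOn-⊆ {f x} B'⊆ constant) rows))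
      addConstant (subgrid A'⊆ B'⊆ A'! B'! _ M≤ (inj₂ many)) =
        subgrid (there ∘ A'⊆) (B₁⊆B ∘ B'⊆) A'! B'! z≤n M≤ (inj₂ many)
  ... | B₁ , B₁⊆B , B₁! , inj₂ (∣B₁∣ , injective) =
    addInjective (manyRows f M (suc p) q A₀! B₁! (subst (_≤ length A₀) (+-suc p q) pq≤) ∣B₁∣)
    where
      addInjective : Subgrid A₀ B₁ 0 M (ManyRows f (suc p) q) → Subgrid (x ∷ A₀) _ 0 M (ManyRows f (suc p) (suc q))
      addInjective (subgrid A'⊆ B'⊆ A'! B'! _ M≤ (inj₂ (q≤ , rows))) =
        subgrid (∷-⊆ A'⊆) (B₁⊆B ∘ B'⊆) (∷-unique x∉A₀ A'⊆ A'!) B'! z≤n M≤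
                (inj₂ (s≤s q≤ , rows-∷ {P = InjectiveOn} (injectiveOn-⊆ {f x} B'⊆ injective) rows))
      addInjective (subgrid A'⊆ B'⊆ A'! B'! _ M≤ (inj₁ many)) =
        subgrid (there ∘ A'⊆) (B₁⊆B ∘ B'⊆) A'! B'! z≤n M≤ (inj₁ many)

  rowType : ∀ f M p {A B} → Unique A → Unique B → p + p ≤ length A → rowBound M p p ≤ length B →
            Subgrid A B p M (RowType f)
  rowType f M p A! B! ∣A∣ ∣B∣ with manyRows f M p p A! B! ∣A∣ ∣B∣
  ... | subgrid A'⊆ B'⊆ A'! B'! _ M≤ (inj₁ (p≤ , rows)) = subgrid A'⊆ B'⊆ A'! B'! p≤ M≤ (inj₁ rows)
  ... | subgrid A'⊆ B'⊆ A'! B'! _ M≤ (inj₂ (p≤ , rows)) = subgrid A'⊆ B'⊆ A'! B'! p≤ M≤ (inj₂ rows)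

  typed : ∀ f M {A B} → Unique A → Unique B → typedBound M ≤ length A → typedBound M ≤ length B →
          Subgrid A B M M (Typed f)
  typed f M A! B! ∣A∣ ∣B∣ =
    rowType f (M + M) (rowBound M M M) A! B! (≤-trans (m≤m+n _ _) ∣A∣) (≤-trans (m≤n+m _ _) ∣B∣)
      >>= λ A₁! B₁! P≤∣A₁∣ 2M≤∣B₁∣ rowType₁ →
    keep rowType-hereditary rowType₁ (transpose (rowType (flip f) M M B₁! A₁! 2M≤∣B₁∣ P≤∣A₁∣))

  simultaneously : ∀ m (bound : ℕ → ℕ) {Inv : Property} {Q : Fin m → Property} →
    Hereditary Inv → (∀ k → Hereditary (Q k)) →
    (∀ k N {A B} → Unique A → Unique B → Inv A B → bound N ≤ length A → bound N ≤ length B → Subgrid A B N N (Q k)) →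
    ∀ M {A B} → Unique A → Unique B → Inv A B → fold M bound m ≤ length A → fold M bound m ≤ length B →
    Subgrid A B M M (λ A' B' → ∀ k → Q k A' B')
  simultaneously zero _ _ _ _ M A! B! _ ∣A∣ ∣B∣ = whole A! B! ∣A∣ ∣B∣ (λ ())
  simultaneously (suc m) bound hInv hQ step M A! B! inv ∣A∣ ∣B∣ =
    keep hInv inv (step Fin.zero (fold M bound m) A! B! inv ∣A∣ ∣B∣) >>= λ A₁! B₁! ∣A₁∣ ∣B₁∣ (inv₁ , q₀) →
    mapProperty (λ (q₀ , qs) → λ { Fin.zero → q₀ ; (Fin.suc k) → qs k })
      (keep (hQ Fin.zero) q₀ (simultaneously m bound hInv (hQ ∘ Fin.suc) (step ∘ Fin.suc) M A₁! B₁! inv₁ ∣A₁∣ ∣B₁∣))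

  Independent : (V → V → Set) → List V → Set
  Independent Conflict I = ∀ {y z} → y ∈ I → z ∈ I → y ≢ z → ¬ Conflict y z

  IndependentSubset : (V → V → Set) → ℕ → List V → Set
  IndependentSubset Conflict s A = Σ (List V) λ I → I ⊆ A × Unique I × length I ≡ s × Independent Conflict I

  -- Greedy choice in a conflict graph of maximum degree d: conflicts z lists all partners of z.
  independentSubset : ∀ (Conflict : V → V → Set) (conflicts : V → List V) d {A} → Unique A →
    (∀ {z} → z ∈ A → length (conflicts z) ≤ d) →
    (∀ {y z} → y ∈ A → z ∈ A → y ≢ z → Conflict y z ⊎ Conflict z y → y ∈ conflicts z) →
    ∀ s → s * suc d ≤ length A → IndependentSubset Conflict s A
  independentSubset Conflict conflicts d A! _ _ zero _ = [] , (λ ()) , [] , refl , λ ()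
  independentSubset Conflict conflicts d {A} A! bounded covers (suc s) ∣A∣ =
    add (independentSubset Conflict conflicts d A! bounded covers s (≤-trans (m≤n+m _ _) ∣A∣))
    where
      add : IndependentSubset Conflict s A → IndependentSubset Conflict (suc s) A
      add (I , I⊆A , I! , refl , independent) = x ∷ I , I'⊆A , ∷-unique x∉I (λ z∈ → z∈) I! , refl , independent'
        where
          neighbourhood : V → List V
          neighbourhood z = z ∷ conflicts z
          forbidden = concatMap neighbourhood I
          ∣forbidden∣<∣A∣ : length forbidden < length A
          ∣forbidden∣<∣A∣ = ≤-trans (s≤s (length-concatMap≤ _ I (λ z∈I → s≤s (bounded (I⊆A z∈I)))))
                                    (≤-trans (s≤s (m≤n+m _ d)) ∣A∣)
          picked = ∃-∉ _≟ᵛ_ A! ∣forbidden∣<∣A∣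
          x = proj₁ picked
          x∈A = proj₁ (proj₂ picked)
          x∉forbidden = proj₂ (proj₂ picked)
          x∉I : All (x ≢_) I
          x∉I = All.tabulate λ z∈I x≡z → x∉forbidden (∈-concatMap⁺ neighbourhood (lose z∈I (here x≡z)))
          x∉conflicts : ∀ {z} → z ∈ I → x ∉ conflicts z
          x∉conflicts z∈I x∈ = x∉forbidden (∈-concatMap⁺ neighbourhood (lose z∈I (there x∈)))
          I'⊆A : x ∷ I ⊆ A
          I'⊆A (here refl) = x∈A
          I'⊆A (there z∈I) = I⊆A z∈I
          independent' : Independent Conflict (x ∷ I)
          independent' (here refl) (here refl) x≢x _ = x≢x refl
          independent' (here refl) (there z∈I) x≢z conflict =
            x∉conflicts z∈I (covers x∈A (I⊆A z∈I) x≢z (inj₁ conflict))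
          independent' (there y∈I) (here refl) y≢x conflict =
            x∉conflicts y∈I (covers x∈A (I⊆A y∈I) (y≢x ∘ sym) (inj₂ conflict))
          independent' (there y∈I) (there z∈I) = independent y∈I z∈I

  rainbow : ∀ f s {A B} → Unique A → Unique B → s ≤ length A → rainbowBound s ≤ length B →
            Rows InjectiveOn f A B → Columns InjectiveOn f A B → Subgrid A B s s (RainbowOn f)
  rainbow f s {A} {B} A! B! ∣A∣ ∣B∣ rowsInjective columnsInjective with takeUnique s A A! ∣A∣
  ... | R , R⊆A , R! , refl with independentSubset Conflict conflicts _ B! conflicts-bounded covers s ∣B∣
    where
      Conflict : V → V → Set
      Conflict y z = ∃ λ x → ∃ λ x' → x ∈ R × x' ∈ R × f x y ≡ f x' z

      matching : V → V → V → List V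
      matching z x x' = filter (λ y → f x y ≟ᶜ f x' z) B

      conflicts : V → List V
      conflicts z = concatMap (λ x → concatMap (matching z x) R) R

      matching-length≤1 : ∀ {z x} x' → x ∈ R → length (matching z x x') ≤ 1
      matching-length≤1 {z} {x} x' x∈R = length≤1 (Unique.filter⁺ _ B!) λ y∈ y'∈ →
        let y∈B , fxy≡ = ∈-filter⁻ (λ y → f x y ≟ᶜ f x' z) {xs = B} y∈
            y'∈B , fxy'≡ = ∈-filter⁻ (λ y → f x y ≟ᶜ f x' z) {xs = B} y'∈
        in rowsInjective (R⊆A x∈R) y∈B y'∈B (trans fxy≡ (sym fxy'≡))

      conflicts-bounded : ∀ {z} → z ∈ B → length (conflicts z) ≤ length R * (length R * 1)
      conflicts-bounded {z} _ =
        length-concatMap≤ _ R λ x∈R → length-concatMap≤ (matching z _) R λ {x'} _ → matching-length≤1 x' x∈R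

      matched : ∀ {y z x x'} → y ∈ B → x ∈ R → x' ∈ R → f x y ≡ f x' z → y ∈ conflicts z
      matched {y} {z} {x} {x'} y∈B x∈R x'∈R eq =
        ∈-concatMap⁺ (λ x → concatMap (matching z x) R) (lose x∈R
          (∈-concatMap⁺ (matching z x) (lose x'∈R (∈-filter⁺ (λ y → f x y ≟ᶜ f x' z) y∈B eq))))

      covers : ∀ {y z} → y ∈ B → z ∈ B → y ≢ z → Conflict y z ⊎ Conflict z y → y ∈ conflicts z
      covers y∈B _ _ (inj₁ (x , x' , x∈R , x'∈R , eq)) = matched y∈B x∈R x'∈R eq
      covers y∈B _ _ (inj₂ (x , x' , x∈R , x'∈R , eq)) = matched y∈B x'∈R x∈R (sym eq)
  ... | I , I⊆B , I! , ∣I∣ , independent = subgrid R⊆A I⊆B R! I! ≤-refl (≤-reflexive (sym ∣I∣)) rainbowOn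
    where
      rainbowOn : RainbowOn f R I
      rainbowOn {x} {x'} {y} {y'} x∈R x'∈R y∈I y'∈I eq with y ≟ᵛ y'
      ... | yes refl = columnsInjective (I⊆B y∈I) (R⊆A x∈R) (R⊆A x'∈R) eq , refl
      ... | no y≢y' = ⊥-elim (independent y∈I y'∈I y≢y' (x , x' , x∈R , x'∈R , eq))

  disjointOn-sym : ∀ {f g A B} → DisjointOn g f A B → DisjointOn f g A B
  disjointOn-sym disjoint x∈ x'∈ y∈ y'∈ eq = disjoint x'∈ x∈ y'∈ y∈ (sym eq)

  disjointOn-transpose : ∀ {f g A B} → DisjointOn (flip f) (flip g) B A → DisjointOn f g A B
  disjointOn-transpose disjoint x∈ x'∈ y∈ y'∈ = disjoint y∈ y'∈ x∈ x'∈

  monochromatic⇒disjoint : ∀ {f g A B} → PointwiseDistinct f g → MonochromaticOn f A B → DisjointOn f g A B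
  monochromatic⇒disjoint distinct (rows , columns) x∈ x'∈ y∈ y'∈ fxy≡gx'y' =
    distinct _ _ (trans (trans (rows x'∈ y'∈ y∈) (columns y∈ x'∈ x∈)) fxy≡gx'y')

  xCanonical-disjoint : ∀ f g M {A B} → PointwiseDistinct f g → Unique A → Unique B →
                        M * 3 ≤ length A → M ≤ length B →
                        XCanonicalOn f A B → XCanonicalOn g A B → Subgrid A B M M (DisjointOn f g)
  xCanonical-disjoint f g M {A} {[]} _ A! B! ∣A∣ ∣B∣ _ _ = whole A! B! (≤-trans (m≤m*n M 3) ∣A∣) ∣B∣ λ _ _ ()
  xCanonical-disjoint f g M {A} {y₀ ∷ B₀} distinct A! B! ∣A∣ ∣B∣ (f-rows , f-columns) (g-rows , g-columns)
    with independentSubset Conflict conflicts 2 A! conflicts-bounded covers M ∣A∣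
    where
      Conflict : V → V → Set
      Conflict x x' = f x y₀ ≡ g x' y₀

      matchesF matchesG : V → List V
      matchesF z = filter (λ x → f x y₀ ≟ᶜ g z y₀) A
      matchesG z = filter (λ x → g x y₀ ≟ᶜ f z y₀) A

      conflicts : V → List V
      conflicts z = matchesF z ++ matchesG z

      column-matches≤1 : ∀ h c → InjectiveOn (λ x → h x y₀) A → length (filter (λ x → h x y₀ ≟ᶜ c) A) ≤ 1
      column-matches≤1 h c injective = length≤1 (Unique.filter⁺ _ A!) λ x∈ x'∈ →
        let x∈A , hx≡c = ∈-filter⁻ (λ x → h x y₀ ≟ᶜ c) {xs = A} x∈
            x'∈A , hx'≡c = ∈-filter⁻ (λ x → h x y₀ ≟ᶜ c) {xs = A} x'∈
        in injective x∈A x'∈A (trans hx≡c (sym hx'≡c))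

      conflicts-bounded : ∀ {z} → z ∈ A → length (conflicts z) ≤ 2
      conflicts-bounded {z} _ = begin
        length (matchesF z ++ matchesG z)           ≡⟨ length-++ (matchesF z) ⟩
        length (matchesF z) + length (matchesG z) ≤⟨ +-mono-≤ (column-matches≤1 f _ (f-columns (here refl)))
                                                               (column-matches≤1 g _ (g-columns (here refl))) ⟩
        2                                           ∎
        where open ≤-Reasoning

      covers : ∀ {y z} → y ∈ A → z ∈ A → y ≢ z → Conflict y z ⊎ Conflict z y → y ∈ conflicts z
      covers {y} {z} y∈A _ _ (inj₁ eq) = ∈-++⁺ˡ (∈-filter⁺ (λ x → f x y₀ ≟ᶜ g z y₀) y∈A eq)
      covers {y} {z} y∈A _ _ (inj₂ eq) = ∈-++⁺ʳ (matchesF z) (∈-filter⁺ (λ x → g x y₀ ≟ᶜ f z y₀) y∈A (sym eq))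
  ... | I , I⊆A , I! , ∣I∣ , independent = subgrid I⊆A (λ y∈ → y∈) I! B! (≤-reflexive (sym ∣I∣)) ∣B∣ I-disjoint
    where
      I-disjoint : DisjointOn f g I (y₀ ∷ B₀)
      I-disjoint {x} {x'} x∈I x'∈I y∈B y'∈B fxy≡gx'y' with x ≟ᵛ x'
      ... | yes refl = distinct x _ (trans fxy≡gx'y' (g-rows (I⊆A x'∈I) y'∈B y∈B))
      ... | no x≢x' = independent x∈I x'∈I x≢x'
        (trans (f-rows (I⊆A x∈I) (here refl) y∈B) (trans fxy≡gx'y' (g-rows (I⊆A x'∈I) y'∈B (here refl))))

  -- Keep M rows; a column is discarded if its colour occurs among the (injectively coloured) kept rows.
  xyCanonical-disjoint : ∀ f g M {A B} → Unique A → Unique B → M ≤ length A → M + M ≤ length B →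
                         XCanonicalOn f A B → YCanonicalOn g A B → Subgrid A B M M (DisjointOn f g)
  xyCanonical-disjoint f g M {[]} A! B! ∣A∣ ∣B∣ _ _ = whole A! B! ∣A∣ (≤-trans (m≤m+n M M) ∣B∣) λ ()
  xyCanonical-disjoint f g M {A} {[]} A! B! ∣A∣ ∣B∣ _ _ = whole A! B! ∣A∣ (≤-trans (m≤m+n M M) ∣B∣) λ _ _ ()
  xyCanonical-disjoint f g M {x₀ ∷ A₀} {y₀ ∷ B₀} A! B! ∣A∣ ∣B∣ (f-rows , f-columns) (g-rows , g-columns)
    with takeUnique M (x₀ ∷ A₀) A! ∣A∣
  ... | R , R⊆A , R! , ∣R∣ =
    subgrid R⊆A (filter-⊆ (∁? used?) B) R! (Unique.filter⁺ (∁? used?) B!) (≤-reflexive (sym ∣R∣)) M≤∣B'∣ R×B'-disjoint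
    where
      B = y₀ ∷ B₀
      Used : V → Set
      Used y = Any (λ x → f x y₀ ≡ g x₀ y) R
      used? : Decidable Used
      used? y = any? (λ x → f x y₀ ≟ᶜ g x₀ y) R
      B' = filter (∁? used?) B

      ∣used∣≤M : length (filter used? B) ≤ M
      ∣used∣≤M = begin
        length (filter used? B)             ≤⟨ injection⇒length≤ _≟ᶜ_ (g x₀) (Unique.filter⁺ used? B!)
                                                                  injective maps ⟩
        length (map (λ x → f x y₀) R)       ≡⟨ length-map _ R ⟩
        length R                            ≡⟨ ∣R∣ ⟩
        M                                   ∎
        where
          open ≤-Reasoning
          injective : ∀ {y y'} → y ∈ filter used? B → y' ∈ filter used? B → g x₀ y ≡ g x₀ y' → y ≡ y'
          injective y∈ y'∈ =
            g-rows (here refl) (proj₁ (∈-filter⁻ used? {xs = B} y∈)) (proj₁ (∈-filter⁻ used? {xs = B} y'∈))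
          maps : ∀ {y} → y ∈ filter used? B → g x₀ y ∈ map (λ x → f x y₀) R
          maps {y} y∈ with find (proj₂ (∈-filter⁻ used? {xs = B} y∈))
          ... | x , x∈R , fxy₀≡gx₀y = subst (_∈ map (λ x → f x y₀) R) fxy₀≡gx₀y (∈-map⁺ (λ x → f x y₀) x∈R)

      M≤∣B'∣ : M ≤ length B'
      M≤∣B'∣ = +-cancelˡ-≤ M _ _ (begin
        M + M                                ≤⟨ ∣B∣ ⟩
        length B                             ≡⟨ length-filter-∁ used? B ⟨
        length (filter used? B) + length B' ≤⟨ +-monoˡ-≤ (length B') ∣used∣≤M ⟩
        M + length B'                        ∎)
        where open ≤-Reasoning

      R×B'-disjoint : DisjointOn f g R B'
      R×B'-disjoint {x} {x'} {y} {y'} x∈R x'∈R y∈B' y'∈B' fxy≡gx'y' =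
        proj₂ (∈-filter⁻ (∁? used?) {xs = B} y'∈B') (lose x∈R (begin
          f x y₀   ≡⟨ f-rows (R⊆A x∈R) (here refl) (filter-⊆ (∁? used?) B y∈B') ⟩
          f x y    ≡⟨ fxy≡gx'y' ⟩
          g x' y'  ≡⟨ g-columns (filter-⊆ (∁? used?) B y'∈B') (R⊆A x'∈R) (here refl) ⟩
          g x₀ y'  ∎))
        where open ≡-Reasoning

  M+M≤M*3 : ∀ M → M + M ≤ M * 3
  M+M≤M*3 M = ≤-trans (+-monoʳ-≤ M (m≤m+n M (M + 0))) (≤-reflexive (*-comm 3 M))

  disjointPair : ∀ f g M {A B} → PointwiseDistinct f g → Unique A → Unique B → M * 3 ≤ length A → M * 3 ≤ length B →
                 Structured f A B → Structured g A B → Subgrid A B M M (DisjointOn f g)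
  disjointPair f g M distinct A! B! ∣A∣ ∣B∣ (inj₁ monochromatic) _ =
    whole A! B! (≤-trans (m≤m*n M 3) ∣A∣) (≤-trans (m≤m*n M 3) ∣B∣) (monochromatic⇒disjoint distinct monochromatic)
  disjointPair f g M distinct A! B! ∣A∣ ∣B∣ _ (inj₁ monochromatic) =
    whole A! B! (≤-trans (m≤m*n M 3) ∣A∣) (≤-trans (m≤m*n M 3) ∣B∣)
          (disjointOn-sym (monochromatic⇒disjoint (λ x y → distinct x y ∘ sym) monochromatic))
  disjointPair f g M distinct A! B! ∣A∣ ∣B∣ (inj₂ (inj₁ xf)) (inj₂ (inj₁ xg)) =
    xCanonical-disjoint f g M distinct A! B! ∣A∣ (≤-trans (m≤m*n M 3) ∣B∣) xf xg
  disjointPair f g M distinct A! B! ∣A∣ ∣B∣ (inj₂ (inj₂ yf)) (inj₂ (inj₂ yg)) =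
    transpose (mapProperty disjointOn-transpose
      (xCanonical-disjoint (flip f) (flip g) M (flip distinct) B! A! ∣B∣ (≤-trans (m≤m*n M 3) ∣A∣)
                           (swap yf) (swap yg)))
  disjointPair f g M distinct A! B! ∣A∣ ∣B∣ (inj₂ (inj₁ xf)) (inj₂ (inj₂ yg)) =
    xyCanonical-disjoint f g M A! B! (≤-trans (m≤m*n M 3) ∣A∣) (≤-trans (M+M≤M*3 M) ∣B∣) xf yg
  disjointPair f g M distinct A! B! ∣A∣ ∣B∣ (inj₂ (inj₂ yf)) (inj₂ (inj₁ xg)) =
    transpose (mapProperty disjointOn-transpose
      (xyCanonical-disjoint (flip f) (flip g) M B! A! (≤-trans (m≤m*n M 3) ∣B∣) (≤-trans (M+M≤M*3 M) ∣A∣)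
                            (swap yf) (swap xg)))

  typed⇒injective⊎structured : ∀ {f A B} → Typed f A B →
                               (Rows InjectiveOn f ∩ Columns InjectiveOn f) A B ⊎ Structured f A B
  typed⇒injective⊎structured (inj₁ rows , inj₁ columns) = inj₂ (inj₁ (rows , columns))
  typed⇒injective⊎structured (inj₁ rows , inj₂ columns) = inj₂ (inj₂ (inj₁ (rows , columns)))
  typed⇒injective⊎structured (inj₂ rows , inj₁ columns) = inj₂ (inj₂ (inj₂ (rows , columns)))
  typed⇒injective⊎structured (inj₂ rows , inj₂ columns) = inj₁ (rows , columns)

  module _ {m : ℕ} (χ : Fin m → V → V → C) where

    AllTyped AllStructured PairwiseDisjointOn SomeRainbow : Property
    AllTyped A B = ∀ k → Typed (χ k) A B
    AllStructured A B = ∀ k → Structured (χ k) A B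
    PairwiseDisjointOn A B = ∀ k l → k ≢ l → DisjointOn (χ k) (χ l) A B
    SomeRainbow A B = ∃ λ k → RainbowOn (χ k) A B

    allStructured-hereditary : Hereditary AllStructured
    allStructured-hereditary A'⊆A B'⊆B structured k = structured-hereditary A'⊆A B'⊆B (structured k)

    allTyped : ∀ M {A B} → Unique A → Unique B → fold M typedBound m ≤ length A → fold M typedBound m ≤ length B →
               Subgrid A B M M AllTyped
    allTyped M A! B! = simultaneously m typedBound {Inv = λ _ _ → ⊤} (λ _ _ _ → tt) (λ _ → typed-hereditary)
                                      (λ k N A! B! _ → typed (χ k) N A! B!) M A! B! tt

    pairwiseDisjoint : (∀ k l → k ≢ l → PointwiseDistinct (χ k) (χ l)) →
      ∀ M {A B} → Unique A → Unique B → AllStructured A B →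
      disjointnessBound m M ≤ length A → disjointnessBound m M ≤ length B →
      Subgrid A B M M PairwiseDisjointOn
    pairwiseDisjoint distinct =
      simultaneously m (λ N → fold N (_* 3) m) allStructured-hereditary (λ _ → pairs-hereditary)
        λ k N A! B! structured →
          simultaneously m (_* 3) allStructured-hereditary (λ _ → pair-hereditary) (pair k) N A! B! structured
      where
        pair-hereditary : ∀ {k l} → Hereditary (λ A B → k ≢ l → DisjointOn (χ k) (χ l) A B)
        pair-hereditary A'⊆A B'⊆B disjoint k≢l = disjointOn-hereditary A'⊆A B'⊆B (disjoint k≢l)

        pairs-hereditary : ∀ {k} → Hereditary (λ A B → ∀ l → k ≢ l → DisjointOn (χ k) (χ l) A B)
        pairs-hereditary A'⊆A B'⊆B disjoint l = pair-hereditary A'⊆A B'⊆B (disjoint l)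

        pair : ∀ k l N {A B} → Unique A → Unique B → AllStructured A B → N * 3 ≤ length A → N * 3 ≤ length B →
               Subgrid A B N N (λ A' B' → k ≢ l → DisjointOn (χ k) (χ l) A' B')
        pair k l N A! B! structured ∣A∣ ∣B∣ with k Fin.≟ l
        ... | yes refl = whole A! B! (≤-trans (m≤m*n N 3) ∣A∣) (≤-trans (m≤m*n N 3) ∣B∣) λ k≢k → ⊥-elim (k≢k refl)
        ... | no k≢l = mapProperty {P = DisjointOn (χ k) (χ l)} (λ disjoint _ → disjoint)
                         (disjointPair (χ k) (χ l) N (distinct k l k≢l) A! B! ∣A∣ ∣B∣ (structured k) (structured l))

    canonicalSubgrid : (∀ k l → k ≢ l → PointwiseDistinct (χ k) (χ l)) →
      ∀ s {A B} → Unique A → Unique B → gridBound m s ≤ length A → gridBound m s ≤ length B →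
      Subgrid A B s s (SomeRainbow ∪ (AllStructured ∩ PairwiseDisjointOn))
    canonicalSubgrid distinct s A! B! ∣A∣ ∣B∣ = allTyped _ A! B! ∣A∣ ∣B∣ >>= λ A₁! B₁! ∣A₁∣ ∣B₁∣ typed₁ →
      case ∃⊎∀ (λ k → typed⇒injective⊎structured (typed₁ k)) of λ where
        (inj₁ (k , rows , columns)) → mapProperty (λ rainbowOn → inj₁ (k , rainbowOn))
          (rainbow (χ k) s A₁! B₁! (≤-trans (≤-trans (m≤m*n s (suc _)) (m≤m+n _ _)) ∣A₁∣)
                                   (≤-trans (m≤m+n _ _) ∣B₁∣) rows columns)
        (inj₂ structured) → mapProperty inj₂ (keep allStructured-hereditary structured
          (pairwiseDisjoint distinct s A₁! B₁! structured (≤-trans (m≤n+m _ _) ∣A₁∣) (≤-trans (m≤n+m _ _) ∣B₁∣)))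

module _ {n t : ℕ} where

  open Grids {Fin t} {Fin n} Fin._≟_ Fin._≟_

  restrict : ∀ {s} {G : Copy n t} → Coloring n t → SubCopy s G → Coloring n s
  restrict χ F i j = χ (as F i) (bs F j)

  subCopyOf : ∀ {s A B P} (G : Copy n t) (S : Subgrid A B s s P) →
              Σ (SubCopy s G) λ F → (∀ i → as F i ∈ Subgrid.A' S) × (∀ j → bs F j ∈ Subgrid.B' S)
  subCopyOf {s} G (subgrid _ _ A'! B'! s≤∣A'∣ s≤∣B'∣ _)
    with enumerate s _ A'! s≤∣A'∣ | enumerate s _ B'! s≤∣B'∣
  ... | a , a-injective , a∈A' | b , b-injective , b∈B' =
    record { as = a ; bs = b ; as-inj = a-injective ; bs-inj = b-injective } , a∈A' , b∈B'

  listColoring-restrict : ∀ {s} (H : ThreeGraph n) {G χ} (F : SubCopy s G) →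
                          IsListColoring H G χ → IsListColoring H (subCopy G F) (restrict χ F)
  listColoring-restrict H {G} F listColoring i j =
    proj₁ (listColoring (as F i) (bs F j)) , proj₂ (listColoring (as F i) (bs F j)) ∘ inV
    where
      inV : ∀ {c} → InV (subCopy G F) c → InV G c
      inV (inj₁ (i' , c≡)) = inj₁ (as F i' , c≡)
      inV (inj₂ (j' , c≡)) = inj₂ (bs F j' , c≡)

  module _ {s} {G : Copy n t} (F : SubCopy s G) {A B} (as∈A : ∀ i → as F i ∈ A) (bs∈B : ∀ j → bs F j ∈ B) where

    rainbowOn⇒rainbow : ∀ {χ} → RainbowOn χ A B → Rainbow (restrict χ F)
    rainbowOn⇒rainbow rainbowOn i j i' j' eq =
      let a≡ , b≡ = rainbowOn (as∈A i) (as∈A i') (bs∈B j) (bs∈B j') eq in as-inj F a≡ , bs-inj F b≡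

    structured⇒monochromatic⊎canonical : ∀ {χ} → Structured χ A B →
                                         Monochromatic (restrict χ F) ⊎ Canonical (restrict χ F)
    structured⇒monochromatic⊎canonical (inj₁ (rows , columns)) =
      inj₁ λ i j i' j' → trans (rows (as∈A i) (bs∈B j) (bs∈B j')) (columns (bs∈B j') (as∈A i) (as∈A i'))
    structured⇒monochromatic⊎canonical (inj₂ (inj₁ (rows , columns))) = inj₂ (inj₁
      ( (λ i j j' → rows (as∈A i) (bs∈B j) (bs∈B j'))
      , λ i i' j j' i≢i' eq → i≢i' (as-inj F (columns (bs∈B j') (as∈A i) (as∈A i')
                                                       (trans (rows (as∈A i) (bs∈B j') (bs∈B j)) eq)))))
    structured⇒monochromatic⊎canonical (inj₂ (inj₂ (rows , columns))) = inj₂ (inj₂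
      ( (λ i i' j → columns (bs∈B j) (as∈A i) (as∈A i'))
      , λ i i' j j' j≢j' eq → j≢j' (bs-inj F (rows (as∈A i') (bs∈B j) (bs∈B j')
                                                    (trans (columns (bs∈B j) (as∈A i') (as∈A i)) eq)))))

    pairwiseDisjointOn⇒pairwiseDisjoint : ∀ {m} {χ : Fin m → Coloring n t} → PairwiseDisjointOn χ A B →
                                          PairwiseDisjoint (λ k → restrict (χ k) F)
    pairwiseDisjointOn⇒pairwiseDisjoint disjoint k l k≢l i j i' j' =
      disjoint k l k≢l (as∈A i) (as∈A i') (bs∈B j) (bs∈B j')

  CanonicalSubCopy : ℕ → ℕ → ThreeGraph n → Copy n t → Set
  CanonicalSubCopy m s H G = Σ (SubCopy s G) λ F →
    (∃ λ (ψ : Coloring n s) → IsListColoring H (subCopy G F) ψ × Rainbow ψ)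
    ⊎ (∃ λ (ψ : Fin m → Coloring n s) → IsMulticoloring m H (subCopy G F) ψ × PairwiseDisjoint ψ ×
                                        (∀ k → Monochromatic (ψ k) ⊎ Canonical (ψ k)))

  canonicalSubCopy : ∀ {m s A B} (H : ThreeGraph n) (G : Copy n t) (χ : Fin m → Coloring n t) →
                     IsMulticoloring m H G χ → Subgrid A B s s (SomeRainbow χ ∪ (AllStructured χ ∩ PairwiseDisjointOn χ)) →
                     CanonicalSubCopy m s H G
  canonicalSubCopy H G χ (listColorings , distinct) S with subCopyOf G S | Subgrid.property S
  ... | F , as∈ , bs∈ | inj₁ (k , rainbowOn) =
    F , inj₁ (restrict (χ k) F , listColoring-restrict H F (listColorings k) , rainbowOn⇒rainbow F as∈ bs∈ rainbowOn)
  ... | F , as∈ , bs∈ | inj₂ (structured , disjoint) =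
    F , inj₂ ( (λ k → restrict (χ k) F)
             , ((λ k → listColoring-restrict H F (listColorings k)) , λ k l i j → distinct k l (as F i) (bs F j))
             , pairwiseDisjointOn⇒pairwiseDisjoint F as∈ bs∈ disjoint
             , λ k → structured⇒monochromatic⊎canonical F as∈ bs∈ (structured k))

theorem4p17 : (m s : ℕ) → ∃ λ t₀ → (t : ℕ) → t₀ ≤ t →
    (n : ℕ) (H : ThreeGraph n) (G : Copy n t) → CopyInShadow H G →
    (∃ λ (χ : Fin m → Coloring n t) → IsMulticoloring m H G χ) →
    Σ (SubCopy s G) λ F →
      (∃ λ (ψ : Coloring n s) → IsListColoring H (subCopy G F) ψ × Rainbow ψ)
      ⊎ (∃ λ (ψ : Fin m → Coloring n s) → IsMulticoloring m H (subCopy G F) ψ × PairwiseDisjoint ψ × (∀ k → Monochromatic (ψ k) ⊎ Canonical (ψ k)))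
theorem4p17 m s = gridBound m s , λ t t₀≤t n H G _ (χ , multicoloring) →
  canonicalSubCopy H G χ multicoloring
    (Grids.canonicalSubgrid Fin._≟_ Fin._≟_ χ (λ k l k≢l x y → proj₂ multicoloring k l x y k≢l) s
      (Unique.allFin⁺ t) (Unique.allFin⁺ t) (t₀≤∣allFin∣ t₀≤t) (t₀≤∣allFin∣ t₀≤t))
  where
    t₀≤∣allFin∣ : ∀ {t} → gridBound m s ≤ t → gridBound m s ≤ length (allFin t)
    t₀≤∣allFin∣ {t} = subst (gridBound m s ≤_) (sym (length-tabulate (λ i → i)))
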